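{- Let $0<\alpha<1$ be irrational with continued fraction $[0,a_1,a_2,\ldots]$ and convergent denominators $q_i$. Let $n\ge1$ have lazy Ostrowski representation $n=\sum_{0\le i\le t} d_iq_i$, let $Y_n$ be the length-$n$ prefix of the characteristic Sturmian word $\mathbf{x}_\alpha$, and let $\mathrm{PER}(n)$ be the set of all periods of $Y_n$ (including $n$). Then $A(n) \subseteq \mathrm{PER}(n)$, where $$A(n) = \Bigl\{ e q_j + \sum_{j < i \leq t} d_i q_i : 0 \leq j \leq t,\ 1 \leq e \leq d_j \Bigr\}.$$
   Context: Let $p_i/q_i=[0,a_1,\ldots,a_i]$ be the convergents of $\alpha$, so $q_0=1$, $q_1=a_1$, $q_i=a_iq_{i-1}+q_{i-2}$. The lazy Ostrowski representation of a positive integer $n$ is the (unique) expression $n=\sum_{0\le i\le t} d_i q_i$ with $d_t>0$ satisfying: $0 \le d_0 < a_1$; $0 \le d_i \le a_{i+1}$ for $i\ge1$; for $2 \le i \le t$, if $d_i=0$ then $d_{i-1}=a_i$; and if $d_1=0$ (with $t\ge1$) then $d_0=a_1-1$. The characteristic Sturmian word $\mathbf{x}_\alpha=x_1x_2\cdots$ is given by $x_i=\lfloor (i+1)\alpha\rfloor-\lfloor i\alpha\rfloor$, $i\ge1$. An integer $p$ with $1\le p\le |w|$ is a period of a finite word $w$ if $w[i]=w[i+p]$ for all $1\le i\le |w|-p$. -}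

module Defs where

open import Data.Nat using (ℕ; zero; suc; _+_; _*_; _∸_; _≤_; _<_; _/_)
open import Data.Product using (_×_)
open import Relation.Binary.PropositionalEquality using (_≡_)

-- α ∈ (0,1) irrational is encoded by its (infinite) sequence of partial
-- quotients  α = [0, a 1, a 2, …]; the value  a 0  is unused.
-- Validity: every partial quotient a_i (i ≥ 1) is ≥ 1.
ValidCF : (ℕ → ℕ) → Set
ValidCF a = ∀ i → 1 ≤ a (suc i)

q : (ℕ → ℕ) → ℕ → ℕ
q a zero = 1
q a (suc zero) = a 1
q a (suc (suc i)) = a (suc (suc i)) * q a (suc i) + q a i

p : (ℕ → ℕ) → ℕ → ℕ
p a zero = 0
p a (suc zero) = 1
p a (suc (suc i)) = a (suc (suc i)) * p a (suc i) + p a i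

-- floor division, total (divisor 0 gives 0; never used for valid a)
_//_ : ℕ → ℕ → ℕ
m // zero = 0
m // suc k = m / suc k

-- ⌊ m α ⌋, computed exactly as ⌊ m p_K / q_K ⌋ with K = m + 2.
-- (For irrational α and m < q_K this equals ⌊ m α ⌋, and q_K ≥ K > m.)
floorMul : (ℕ → ℕ) → ℕ → ℕ
floorMul a m = (m * p a (m + 2)) // q a (m + 2)

x : (ℕ → ℕ) → ℕ → ℕ
x a i = floorMul a (suc i) ∸ floorMul a i

sumTo : (ℕ → ℕ) → ℕ → ℕ
sumTo f zero = 0
sumTo f (suc k) = sumTo f k + f k

IsPeriodOfPrefix : (ℕ → ℕ) → ℕ → ℕ → Set
IsPeriodOfPrefix a n per =
  1 ≤ per × per ≤ n ×
  (∀ i → 1 ≤ i → i + per ≤ n → x a i ≡ x a (i + per))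

IsLazyOstrowski : (ℕ → ℕ) → ℕ → (ℕ → ℕ) → ℕ → Set
IsLazyOstrowski a t d n =
  n ≡ sumTo (λ i → d i * q a i) (suc t) ×
  0 < d t ×
  d 0 < a 1 ×
  (∀ i → 1 ≤ i → i ≤ t → d i ≤ a (suc i)) ×
  (∀ i → 2 ≤ i → i ≤ t → d i ≡ 0 → d (i ∸ 1) ≡ a i) ×
  (1 ≤ t → d 1 ≡ 0 → d 0 ≡ a 1 ∸ 1)

tailSum : (ℕ → ℕ) → (ℕ → ℕ) → ℕ → ℕ → ℕ
tailSum a d j t = sumTo (λ k → d (suc j + k) * q a (suc j + k)) (t ∸ j)

{-# OPTIONS --safe #-}

-- Consecutive convergents pₖ/qₖ, pₖ₊₁/qₖ₊₁ are Farey neighbours (pₖ₊₁qₖ − pₖqₖ₊₁ = ±1). Hence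
-- ⌊m p_K/q_K⌋ is the same for every K with m < q_K: floorMul computes ⌊mα⌋ with one such K, and any
-- other may be used instead. Take K = k + 2. A fraction M/i with 0 < i < qₖ₊₁ cannot lie between the
-- neighbours pₖ/qₖ and pₖ₊₁/qₖ₊₁, which gives ⌊(qₖ + i) p_K/q_K⌋ = pₖ + ⌊i p_K/q_K⌋, and so
-- x_{qₖ+i} = xᵢ for 0 < i < qₖ₊₁ − 1. Iterating, the prefix of length L recurs at offset e qₖ whenever
-- e qₖ + L ≤ qₖ₊₁ + qₖ − 2, and the digit bounds give Σ_{i≤j} dᵢqᵢ ≤ qⱼ₊₁ + qⱼ − 2. Stacking the blocks
-- dₜqₜ, …, dⱼ₊₁qⱼ₊₁, e qⱼ from the top, the prefix of length n − s recurs at offset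
-- s = e qⱼ + Σ_{i>j} dᵢqᵢ, i.e. s is a period of Yₙ.
module Submission where

open import Data.Nat
open import Data.Nat.Properties
open import Data.Nat.DivMod using (m≡m%n+[m/n]*n; m%n<n; m/n*n≤m; m*n/n≡m; /-monoˡ-≤; m<n*o⇒m/o<n)
open import Data.Nat.Tactic.RingSolver using (solve; solve-∀)
open import Data.List using (_∷_; [])
open import Data.Product using (_×_; _,_; uncurry)
open import Data.Sum using (_⊎_; inj₁; inj₂)
open import Relation.Binary using (Tri; tri<; tri≈; tri>)
open import Relation.Binary.PropositionalEquality
open import Relation.Nullary using (contradiction)

open import Defs

//-lower : ∀ M Q → M // Q * Q ≤ M
//-lower M zero    = z≤n
//-lower M (suc Q) = m/n*n≤m M (suc Q)

//-upper : ∀ M Q → 1 ≤ Q → M < suc (M // Q) * Q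
//-upper M (suc Q) _ = begin-strict
  M                              ≡⟨ m≡m%n+[m/n]*n M (suc Q) ⟩
  M % suc Q + M / suc Q * suc Q  <⟨ +-monoˡ-< _ (m%n<n M (suc Q)) ⟩
  suc Q + M / suc Q * suc Q      ∎
  where open ≤-Reasoning

//-unique : ∀ {Q M} N → N * Q ≤ M → M < suc N * Q → M // Q ≡ N
//-unique {zero}  {M} N _ M<0 = contradiction (subst (M <_) (*-zeroʳ N) M<0) n≮0
//-unique {suc Q} {M} N lo hi = ≤-antisym (≤-pred (m<n*o⇒m/o<n hi)) (begin
  N                  ≡⟨ m*n/n≡m N (suc Q) ⟨
  N * suc Q / suc Q  ≤⟨ /-monoˡ-≤ (suc Q) lo ⟩
  M / suc Q          ∎)
  where open ≤-Reasoning

-- The hypotheses say X/Q ≤ Y/Q′ < (X+1)/Q, and no integer lies strictly between X/Q and (X+1)/Q.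
//-between : ∀ {X Y Q Q′} → 1 ≤ Q → Q′ * X ≤ Q * Y → Q * Y < Q′ * suc X → X // Q ≡ Y // Q′
//-between {X} {Y} {Q} {Q′} 0<Q lo hi =
  sym (uncurry (//-unique (X // Q)) (bounds (X // Q) (//-lower X Q) (//-upper X Q 0<Q)))
  where
  bounds : ∀ N → N * Q ≤ X → X < suc N * Q → N * Q′ ≤ Y × Y < suc N * Q′
  bounds N NQ≤X X<N′Q = *-cancelˡ-≤ Q {{>-nonZero 0<Q}} (begin
      Q * (N * Q′)  ≡⟨ solve (Q ∷ N ∷ Q′ ∷ []) ⟩
      Q′ * (N * Q)  ≤⟨ *-monoʳ-≤ Q′ NQ≤X ⟩
      Q′ * X        ≤⟨ lo ⟩
      Q * Y         ∎)
    , *-cancelˡ-< Q Y (suc N * Q′) (begin-strict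
      Q * Y               <⟨ hi ⟩
      Q′ * suc X          ≤⟨ *-monoʳ-≤ Q′ X<N′Q ⟩
      Q′ * (suc N * Q)    ≡⟨ solve (Q′ ∷ N ∷ Q ∷ []) ⟩
      Q * (suc N * Q′)    ∎)
    where open ≤-Reasoning

FareyNeighbours : ℕ → ℕ → ℕ → ℕ → Set
FareyNeighbours p₀ q₀ p₁ q₁ = p₁ * q₀ ≡ 1 + p₀ * q₁

Adjacent : ℕ → ℕ → ℕ → ℕ → Set
Adjacent p₀ q₀ p₁ q₁ = FareyNeighbours p₀ q₀ p₁ q₁ ⊎ FareyNeighbours p₁ q₁ p₀ q₀

adjacent-next : ∀ {p₀ q₀ p₁ q₁} A → Adjacent p₀ q₀ p₁ q₁ →
                Adjacent p₁ q₁ (A * p₁ + p₀) (A * q₁ + q₀)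
adjacent-next {p₀} {q₀} {p₁} {q₁} A (inj₁ det) = inj₂ (begin
  p₁ * (A * q₁ + q₀)           ≡⟨ solve (p₁ ∷ A ∷ q₁ ∷ q₀ ∷ []) ⟩
  A * p₁ * q₁ + p₁ * q₀        ≡⟨ cong (A * p₁ * q₁ +_) det ⟩
  A * p₁ * q₁ + (1 + p₀ * q₁)  ≡⟨ solve (A ∷ p₁ ∷ q₁ ∷ p₀ ∷ []) ⟩
  1 + (A * p₁ + p₀) * q₁       ∎)
  where open ≡-Reasoning
adjacent-next {p₀} {q₀} {p₁} {q₁} A (inj₂ det) = inj₁ (begin
  (A * p₁ + p₀) * q₁           ≡⟨ solve (A ∷ p₁ ∷ q₁ ∷ p₀ ∷ []) ⟩
  A * p₁ * q₁ + p₀ * q₁        ≡⟨ cong (A * p₁ * q₁ +_) det ⟩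
  A * p₁ * q₁ + (1 + p₁ * q₀)  ≡⟨ solve (A ∷ p₁ ∷ q₁ ∷ q₀ ∷ []) ⟩
  1 + p₁ * (A * q₁ + q₀)       ∎)
  where open ≡-Reasoning

//-stable-neighbours : ∀ {p₀ q₀ p₁ q₁} m → FareyNeighbours p₀ q₀ p₁ q₁ → 1 ≤ q₀ → m < q₁ →
                       (m * p₀) // q₀ ≡ (m * p₁) // q₁
//-stable-neighbours {p₀} {q₀} {p₁} {q₁} m det 0<q₀ m<q₁ = //-between {Q′ = q₁} 0<q₀
  (subst (q₁ * (m * p₀) ≤_) (sym scaled) (m≤n+m _ m))
  (begin-strict
    q₀ * (m * p₁)        ≡⟨ scaled ⟩
    m + q₁ * (m * p₀)    <⟨ +-monoˡ-< _ m<q₁ ⟩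
    q₁ + q₁ * (m * p₀)   ≡⟨ *-suc q₁ (m * p₀) ⟨
    q₁ * suc (m * p₀)    ∎)
  where
  open ≤-Reasoning
  scaled : q₀ * (m * p₁) ≡ m + q₁ * (m * p₀)
  scaled = begin-equality
    q₀ * (m * p₁)      ≡⟨ solve (q₀ ∷ m ∷ p₁ ∷ []) ⟩
    m * (p₁ * q₀)      ≡⟨ cong (m *_) det ⟩
    m * (1 + p₀ * q₁)  ≡⟨ solve (m ∷ p₀ ∷ q₁ ∷ []) ⟩
    m + q₁ * (m * p₀)  ∎

//-stable : ∀ {p₀ q₀ p₁ q₁} m → Adjacent p₀ q₀ p₁ q₁ → m < q₀ → m < q₁ →
            (m * p₀) // q₀ ≡ (m * p₁) // q₁
//-stable m (inj₁ det) m<q₀ m<q₁ = //-stable-neighbours m det (≤-trans (s≤s z≤n) m<q₀) m<q₁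
//-stable m (inj₂ det) m<q₀ m<q₁ = sym (//-stable-neighbours m det (≤-trans (s≤s z≤n) m<q₁) m<q₀)

-- For Xⱼ = M qⱼ and Yⱼ = i pⱼ the equation is i times p₁q₀ = 1 + p₀q₁, and the conclusion says that
-- M/i, whose denominator is below q₁, does not lie in (p₀/q₀, p₁/q₁]. Exchanging X and Y covers
-- neighbours in the other order.
farey-gap : ∀ {i q₀ q₁ X₀ Y₀ X₁ Y₁} → 0 < i → i < q₁ →
            q₁ * X₀ + q₀ * Y₁ ≡ i + q₁ * Y₀ + q₀ * X₁ →
            (Y₀ < X₀ × Y₁ < X₁) ⊎ (X₀ ≤ Y₀ × X₁ < Y₁)
farey-gap {i} {q₀} {q₁} {X₀} {Y₀} {X₁} {Y₁} 0<i i<q₁ eq = by-cases (<-cmp Y₁ X₁)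
  where
  open ≤-Reasoning
  above : Y₁ ≤ X₁ → Y₀ < X₀
  above Y₁≤X₁ = *-cancelˡ-< q₁ Y₀ X₀ (begin-strict
    q₁ * Y₀      <⟨ m<n+m (q₁ * Y₀) 0<i ⟩
    i + q₁ * Y₀  ≤⟨ +-cancelʳ-≤ (q₀ * Y₁) (i + q₁ * Y₀) (q₁ * X₀) (begin
      i + q₁ * Y₀ + q₀ * Y₁  ≤⟨ +-monoʳ-≤ (i + q₁ * Y₀) (*-monoʳ-≤ q₀ Y₁≤X₁) ⟩
      i + q₁ * Y₀ + q₀ * X₁  ≡⟨ eq ⟨
      q₁ * X₀ + q₀ * Y₁      ∎) ⟩
    q₁ * X₀      ∎)
  below : X₁ ≤ Y₁ → X₀ ≤ Y₀
  below X₁≤Y₁ = ≤-pred (*-cancelˡ-< q₁ X₀ (suc Y₀) (begin-strict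
    q₁ * X₀       ≤⟨ +-cancelʳ-≤ (q₀ * Y₁) (q₁ * X₀) (i + q₁ * Y₀) (begin
      q₁ * X₀ + q₀ * Y₁      ≡⟨ eq ⟩
      i + q₁ * Y₀ + q₀ * X₁  ≤⟨ +-monoʳ-≤ (i + q₁ * Y₀) (*-monoʳ-≤ q₀ X₁≤Y₁) ⟩
      i + q₁ * Y₀ + q₀ * Y₁  ∎) ⟩
    i + q₁ * Y₀   <⟨ +-monoˡ-< (q₁ * Y₀) i<q₁ ⟩
    q₁ + q₁ * Y₀  ≡⟨ *-suc q₁ Y₀ ⟨
    q₁ * suc Y₀   ∎))
  by-cases : Tri (Y₁ < X₁) (Y₁ ≡ X₁) (X₁ < Y₁) → (Y₀ < X₀ × Y₁ < X₁) ⊎ (X₀ ≤ Y₀ × X₁ < Y₁)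
  by-cases (tri< Y₁<X₁ _ _) = inj₁ (above (<⇒≤ Y₁<X₁) , Y₁<X₁)
  by-cases (tri≈ _ Y₁≡X₁ _) = contradiction (below (≤-reflexive (sym Y₁≡X₁))) (<⇒≱ (above (≤-reflexive Y₁≡X₁)))
  by-cases (tri> _ _ X₁<Y₁) = inj₂ (below (<⇒≤ X₁<Y₁) , X₁<Y₁)

no-multiple-above : ∀ {p₀ q₀ p₁ q₁ A i} M → FareyNeighbours p₀ q₀ p₁ q₁ → 0 < i → i < q₁ →
                    i * (A * p₁ + p₀) < M * (A * q₁ + q₀) →
                    i * (A * p₁ + p₀) + A < M * (A * q₁ + q₀)
no-multiple-above {p₀} {q₀} {p₁} {q₁} {A} {i} M det 0<i i<q₁ iP<MQ
  with farey-gap {q₀ = q₀} {X₀ = M * q₀} {i * p₀} {M * q₁} {i * p₁} 0<i i<q₁ (begin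
    q₁ * (M * q₀) + q₀ * (i * p₁)      ≡⟨ solve (q₁ ∷ M ∷ q₀ ∷ i ∷ p₁ ∷ []) ⟩
    q₁ * (M * q₀) + i * (p₁ * q₀)      ≡⟨ cong (λ d → q₁ * (M * q₀) + i * d) det ⟩
    q₁ * (M * q₀) + i * (1 + p₀ * q₁)  ≡⟨ solve (q₁ ∷ M ∷ q₀ ∷ i ∷ p₀ ∷ []) ⟩
    i + q₁ * (i * p₀) + q₀ * (M * q₁)  ∎)
  where open ≡-Reasoning
... | inj₁ (ip₀<Mq₀ , ip₁<Mq₁) = begin-strict
  i * (A * p₁ + p₀) + A      ≡⟨ solve (i ∷ A ∷ p₁ ∷ p₀ ∷ []) ⟩
  A * suc (i * p₁) + i * p₀  <⟨ +-mono-≤-< (*-monoʳ-≤ A ip₁<Mq₁) ip₀<Mq₀ ⟩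
  A * (M * q₁) + M * q₀      ≡⟨ solve (M ∷ A ∷ q₁ ∷ q₀ ∷ []) ⟩
  M * (A * q₁ + q₀)          ∎
  where open ≤-Reasoning
... | inj₂ (Mq₀≤ip₀ , Mq₁<ip₁) = contradiction iP<MQ (≤⇒≯ (begin
  M * (A * q₁ + q₀)          ≡⟨ solve (M ∷ A ∷ q₁ ∷ q₀ ∷ []) ⟩
  A * (M * q₁) + M * q₀      ≤⟨ +-mono-≤ (*-monoʳ-≤ A (<⇒≤ Mq₁<ip₁)) Mq₀≤ip₀ ⟩
  A * (i * p₁) + i * p₀      ≡⟨ solve (i ∷ A ∷ p₁ ∷ p₀ ∷ []) ⟩
  i * (A * p₁ + p₀)          ∎))
  where open ≤-Reasoning

no-multiple-below : ∀ {p₀ q₀ p₁ q₁ A i} N → FareyNeighbours p₁ q₁ p₀ q₀ → 0 < A → 0 < i → i < q₁ →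
                    N * (A * q₁ + q₀) ≤ i * (A * p₁ + p₀) →
                    N * (A * q₁ + q₀) + A ≤ i * (A * p₁ + p₀)
no-multiple-below {p₀} {q₀} {p₁} {q₁} {A} {i} N det 0<A 0<i i<q₁ NQ≤iP
  with farey-gap {q₀ = q₀} {X₀ = i * p₀} {N * q₀} {i * p₁} {N * q₁} 0<i i<q₁ (begin
    q₁ * (i * p₀) + q₀ * (N * q₁)      ≡⟨ solve (q₁ ∷ i ∷ p₀ ∷ q₀ ∷ N ∷ []) ⟩
    i * (p₀ * q₁) + q₀ * (N * q₁)      ≡⟨ cong (λ d → i * d + q₀ * (N * q₁)) det ⟩
    i * (1 + p₁ * q₀) + q₀ * (N * q₁)  ≡⟨ solve (i ∷ p₁ ∷ q₀ ∷ N ∷ q₁ ∷ []) ⟩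
    i + q₁ * (N * q₀) + q₀ * (i * p₁)  ∎)
  where open ≡-Reasoning
... | inj₁ (Nq₀<ip₀ , Nq₁<ip₁) = begin
  N * (A * q₁ + q₀) + A      ≡⟨ solve (N ∷ A ∷ q₁ ∷ q₀ ∷ []) ⟩
  A * suc (N * q₁) + N * q₀  ≤⟨ +-mono-≤ (*-monoʳ-≤ A Nq₁<ip₁) (<⇒≤ Nq₀<ip₀) ⟩
  A * (i * p₁) + i * p₀      ≡⟨ solve (i ∷ A ∷ p₁ ∷ p₀ ∷ []) ⟩
  i * (A * p₁ + p₀)          ∎
  where open ≤-Reasoning
... | inj₂ (ip₀≤Nq₀ , ip₁<Nq₁) = contradiction NQ≤iP (<⇒≱ (begin-strict
  i * (A * p₁ + p₀)          ≡⟨ solve (i ∷ A ∷ p₁ ∷ p₀ ∷ []) ⟩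
  A * (i * p₁) + i * p₀      <⟨ +-mono-<-≤ (*-monoʳ-< A {{>-nonZero 0<A}} ip₁<Nq₁) ip₀≤Nq₀ ⟩
  A * (N * q₁) + N * q₀      ≡⟨ solve (N ∷ A ∷ q₁ ∷ q₀ ∷ []) ⟩
  N * (A * q₁ + q₀)          ∎))
  where open ≤-Reasoning

shift-identity-ascending : ∀ {p₀ q₀ p₁ q₁ A} i → FareyNeighbours p₀ q₀ p₁ q₁ →
  (q₀ + i) * (A * p₁ + p₀) ≡ p₀ * (A * q₁ + q₀) + (i * (A * p₁ + p₀) + A)
shift-identity-ascending {p₀} {q₀} {p₁} {q₁} {A} i det = begin
  (q₀ + i) * (A * p₁ + p₀)                        ≡⟨ solve (q₀ ∷ i ∷ A ∷ p₁ ∷ p₀ ∷ []) ⟩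
  A * (p₁ * q₀) + p₀ * q₀ + i * (A * p₁ + p₀)      ≡⟨ cong (λ d → A * d + p₀ * q₀ + i * (A * p₁ + p₀)) det ⟩
  A * (1 + p₀ * q₁) + p₀ * q₀ + i * (A * p₁ + p₀)  ≡⟨ solve (A ∷ p₀ ∷ q₁ ∷ q₀ ∷ i ∷ p₁ ∷ []) ⟩
  p₀ * (A * q₁ + q₀) + (i * (A * p₁ + p₀) + A)     ∎
  where open ≡-Reasoning

shift-identity-descending : ∀ {p₀ q₀ p₁ q₁ A} i → FareyNeighbours p₁ q₁ p₀ q₀ →
  (q₀ + i) * (A * p₁ + p₀) + A ≡ p₀ * (A * q₁ + q₀) + i * (A * p₁ + p₀)
shift-identity-descending {p₀} {q₀} {p₁} {q₁} {A} i det = begin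
  (q₀ + i) * (A * p₁ + p₀) + A                    ≡⟨ solve (q₀ ∷ i ∷ A ∷ p₁ ∷ p₀ ∷ []) ⟩
  A * (1 + p₁ * q₀) + p₀ * q₀ + i * (A * p₁ + p₀)  ≡⟨ cong (λ d → A * d + p₀ * q₀ + i * (A * p₁ + p₀)) det ⟨
  A * (p₀ * q₁) + p₀ * q₀ + i * (A * p₁ + p₀)      ≡⟨ solve (A ∷ p₀ ∷ q₁ ∷ q₀ ∷ i ∷ p₁ ∷ []) ⟩
  p₀ * (A * q₁ + q₀) + i * (A * p₁ + p₀)           ∎
  where open ≡-Reasoning

//-shift : ∀ {p₀ q₀ p₁ q₁ A i} → Adjacent p₀ q₀ p₁ q₁ → 0 < A → 0 < i → i < q₁ →
           ((q₀ + i) * (A * p₁ + p₀)) // (A * q₁ + q₀) ≡ p₀ + (i * (A * p₁ + p₀)) // (A * q₁ + q₀)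
//-shift {p₀} {q₀} {p₁} {q₁} {A} {i} adj 0<A 0<i i<q₁ =
  uncurry (//-unique _) (bounds adj ((i * P) // Q) (//-lower (i * P) Q) (//-upper (i * P) Q 0<Q))
  where
  open ≤-Reasoning
  P Q : ℕ
  P = A * p₁ + p₀
  Q = A * q₁ + q₀
  0<Q : 0 < Q
  0<Q = ≤-trans (*-mono-≤ 0<A (≤-trans (s≤s z≤n) i<q₁)) (m≤m+n (A * q₁) q₀)
  bounds : Adjacent p₀ q₀ p₁ q₁ → ∀ N → N * Q ≤ i * P → i * P < suc N * Q →
           (p₀ + N) * Q ≤ (q₀ + i) * P × (q₀ + i) * P < suc (p₀ + N) * Q
  bounds (inj₁ det) N NQ≤iP iP<N′Q =
      (begin
        (p₀ + N) * Q                       ≡⟨ *-distribʳ-+ Q p₀ N ⟩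
        p₀ * Q + N * Q                     ≤⟨ +-monoʳ-≤ (p₀ * Q) (≤-trans NQ≤iP (m≤m+n (i * P) A)) ⟩
        p₀ * Q + (i * P + A)               ≡⟨ split ⟨
        (q₀ + i) * P                       ∎)
    , (begin-strict
        (q₀ + i) * P                       ≡⟨ split ⟩
        p₀ * Q + (i * P + A)               <⟨ +-monoʳ-< (p₀ * Q) (no-multiple-above (suc N) det 0<i i<q₁ iP<N′Q) ⟩
        p₀ * Q + suc N * Q                 ≡⟨ *-distribʳ-+ Q p₀ (suc N) ⟨
        (p₀ + suc N) * Q                   ≡⟨ cong (_* Q) (+-suc p₀ N) ⟩
        suc (p₀ + N) * Q                   ∎)
    where
    split : (q₀ + i) * P ≡ p₀ * Q + (i * P + A)
    split = shift-identity-ascending {p₀} {q₀} {p₁} {q₁} {A} i det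
  bounds (inj₂ det) N NQ≤iP iP<N′Q =
      +-cancelʳ-≤ A _ _ (begin
        (p₀ + N) * Q + A                   ≡⟨ cong (_+ A) (*-distribʳ-+ Q p₀ N) ⟩
        p₀ * Q + N * Q + A                 ≡⟨ +-assoc (p₀ * Q) (N * Q) A ⟩
        p₀ * Q + (N * Q + A)               ≤⟨ +-monoʳ-≤ (p₀ * Q) (no-multiple-below N det 0<A 0<i i<q₁ NQ≤iP) ⟩
        p₀ * Q + i * P                     ≡⟨ split ⟨
        (q₀ + i) * P + A                   ∎)
    , (begin-strict
        (q₀ + i) * P                       ≤⟨ m≤m+n ((q₀ + i) * P) A ⟩
        (q₀ + i) * P + A                   ≡⟨ split ⟩
        p₀ * Q + i * P                     <⟨ +-monoʳ-< (p₀ * Q) iP<N′Q ⟩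
        p₀ * Q + suc N * Q                 ≡⟨ *-distribʳ-+ Q p₀ (suc N) ⟨
        (p₀ + suc N) * Q                   ≡⟨ cong (_* Q) (+-suc p₀ N) ⟩
        suc (p₀ + N) * Q                   ∎)
    where
    split : (q₀ + i) * P + A ≡ p₀ * Q + i * P
    split = shift-identity-descending {p₀} {q₀} {p₁} {q₁} {A} i det

sumTo-+ : ∀ (g : ℕ → ℕ) m n → sumTo g (m + n) ≡ sumTo g m + sumTo (λ k → g (m + k)) n
sumTo-+ g m zero    = trans (cong (sumTo g) (+-identityʳ m)) (sym (+-identityʳ (sumTo g m)))
sumTo-+ g m (suc n) = begin
  sumTo g (m + suc n)                                         ≡⟨ cong (sumTo g) (+-suc m n) ⟩
  sumTo g (m + n) + g (m + n)                                 ≡⟨ cong (_+ g (m + n)) (sumTo-+ g m n) ⟩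
  sumTo g m + sumTo (λ k → g (m + k)) n + g (m + n)           ≡⟨ +-assoc (sumTo g m) _ _ ⟩
  sumTo g m + (sumTo (λ k → g (m + k)) n + g (m + n))         ∎
  where open ≡-Reasoning

convergents-adjacent : ∀ a k → Adjacent (p a k) (q a k) (p a (suc k)) (q a (suc k))
convergents-adjacent a zero    = inj₁ refl
convergents-adjacent a (suc k) = adjacent-next (a (suc (suc k))) (convergents-adjacent a k)

module Sturmian (a : ℕ → ℕ) (valid : ValidCF a) where

  q-pos : ∀ k → 0 < q a k
  q-pos zero          = s≤s z≤n
  q-pos (suc zero)    = valid 0
  q-pos (suc (suc k)) = ≤-trans (q-pos k) (m≤n+m (q a k) _)

  q-add : ∀ k → q a k + q a (suc k) ≤ q a (suc (suc k))
  q-add k = begin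
    q a k + q a (suc k)                        ≡⟨ +-comm (q a k) _ ⟩
    q a (suc k) + q a k                        ≤⟨ +-monoˡ-≤ (q a k) (m≤n*m _ _ {{>-nonZero (valid (suc k))}}) ⟩
    a (suc (suc k)) * q a (suc k) + q a k      ∎
    where open ≤-Reasoning

  q-mono : ∀ k → q a k ≤ q a (suc k)
  q-mono zero    = valid 0
  q-mono (suc k) = ≤-trans (m≤n+m (q a (suc k)) (q a k)) (q-add k)

  q-mono-+ : ∀ d K → q a K ≤ q a (d + K)
  q-mono-+ zero    K = ≤-refl
  q-mono-+ (suc d) K = ≤-trans (q-mono-+ d K) (q-mono (d + K))

  <q-suc : ∀ k → k < q a (suc k)
  <q-suc zero    = valid 0
  <q-suc (suc k) = ≤-<-trans (<q-suc k) (<-≤-trans (m<n+m (q a (suc k)) (q-pos k)) (q-add k))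

  floorAt : ℕ → ℕ → ℕ
  floorAt K m = (m * p a K) // q a K

  floorAt-stable : ∀ d {K m} → m < q a K → floorAt K m ≡ floorAt (d + K) m
  floorAt-stable zero          _    = refl
  floorAt-stable (suc d) {K} {m} m<q = trans (floorAt-stable d m<q)
    (//-stable m (convergents-adjacent a (d + K))
      (<-≤-trans m<q (q-mono-+ d K)) (<-≤-trans m<q (q-mono-+ (suc d) K)))

  floorMul-at : ∀ K {m} → m < q a K → floorMul a m ≡ floorAt K m
  floorMul-at K {m} m<q = begin
    floorAt (m + 2) m        ≡⟨ floorAt-stable K m<q[m+2] ⟩
    floorAt (K + (m + 2)) m  ≡⟨ cong (λ K′ → floorAt K′ m) (+-comm K (m + 2)) ⟩
    floorAt (m + 2 + K) m    ≡⟨ floorAt-stable (m + 2) m<q ⟨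
    floorAt K m              ∎
    where
    open ≡-Reasoning
    m<q[m+2] : m < q a (m + 2)
    m<q[m+2] = subst (λ K′ → m < q a K′) (+-comm 2 m) (<-≤-trans (<q-suc m) (q-mono (suc m)))

  x-at : ∀ K {m} → suc m < q a K → x a m ≡ floorAt K (suc m) ∸ floorAt K m
  x-at K 1+m<q = cong₂ _∸_ (floorMul-at K 1+m<q) (floorMul-at K (<-trans (n<1+n _) 1+m<q))

  floorAt-shift : ∀ {k i} → 0 < i → i < q a (suc k) → floorAt (2 + k) (q a k + i) ≡ p a k + floorAt (2 + k) i
  floorAt-shift {k} 0<i i<q = //-shift (convergents-adjacent a k) (valid (suc k)) 0<i i<q

  x-shift : ∀ {k i} → 0 < i → suc i < q a (suc k) → x a (q a k + i) ≡ x a i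
  x-shift {k} {i} 0<i 1+i<q = begin
    x a (q a k + i)                                        ≡⟨ x-at K 1+qₖ+i<q ⟩
    floorAt K (suc (q a k + i)) ∸ floorAt K (q a k + i)    ≡⟨ cong (λ m → floorAt K m ∸ floorAt K (q a k + i)) (+-suc (q a k) i) ⟨
    floorAt K (q a k + suc i) ∸ floorAt K (q a k + i)      ≡⟨ cong₂ _∸_ (floorAt-shift (s≤s z≤n) 1+i<q)
                                                                        (floorAt-shift 0<i (<-trans (n<1+n i) 1+i<q)) ⟩
    p a k + floorAt K (suc i) ∸ (p a k + floorAt K i)      ≡⟨ [m+n]∸[m+o]≡n∸o (p a k) _ _ ⟩
    floorAt K (suc i) ∸ floorAt K i                        ≡⟨ x-at K (<-≤-trans 1+i<q (q-mono (suc k))) ⟨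
    x a i                                                  ∎
    where
    open ≡-Reasoning
    K : ℕ
    K = 2 + k
    1+qₖ+i<q : suc (q a k + i) < q a K
    1+qₖ+i<q = subst (_< q a K) (+-suc (q a k) i) (<-≤-trans (+-monoʳ-< (q a k) 1+i<q) (q-add k))

  PrefixRecurs : ℕ → ℕ → Set
  PrefixRecurs s L = ∀ i → 0 < i → i ≤ L → x a (s + i) ≡ x a i

  recurs-zero : ∀ L → PrefixRecurs 0 L
  recurs-zero L i _ _ = refl

  recurs-+ : ∀ {s L₁ L₂} → PrefixRecurs s (L₁ + L₂) → PrefixRecurs L₁ L₂ → PrefixRecurs (s + L₁) L₂
  recurs-+ {s} {L₁} {L₂} rec-s rec-L₁ i 0<i i≤L₂ = begin
    x a (s + L₁ + i)    ≡⟨ cong (x a) (+-assoc s L₁ i) ⟩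
    x a (s + (L₁ + i))  ≡⟨ rec-s (L₁ + i) (≤-trans 0<i (m≤n+m i L₁)) (+-monoʳ-≤ L₁ i≤L₂) ⟩
    x a (L₁ + i)        ≡⟨ rec-L₁ i 0<i i≤L₂ ⟩
    x a i               ∎
    where open ≡-Reasoning

  recurs-q : ∀ k {L} → suc L < q a (suc k) → PrefixRecurs (q a k) L
  recurs-q k 1+L<q i 0<i i≤L = x-shift {k} 0<i (≤-<-trans (s≤s i≤L) 1+L<q)

  recurs-multiple : ∀ k {L} e → e * q a k + suc L < q a (suc k) + q a k → PrefixRecurs (e * q a k) L
  recurs-multiple k zero    _     = recurs-zero _
  recurs-multiple k {L} (suc e) bound =
    recurs-+ {q a k} {e * q a k} (recurs-q k first-copy) (recurs-multiple k e other-copies)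
    where
    first-copy : suc (e * q a k + L) < q a (suc k)
    first-copy = +-cancelˡ-< (q a k) _ _ (begin-strict
      q a k + suc (e * q a k + L)  ≡⟨ cong (q a k +_) (+-suc (e * q a k) L) ⟨
      q a k + (e * q a k + suc L)  ≡⟨ +-assoc (q a k) (e * q a k) (suc L) ⟨
      q a k + e * q a k + suc L    <⟨ bound ⟩
      q a (suc k) + q a k          ≡⟨ +-comm (q a (suc k)) (q a k) ⟩
      q a k + q a (suc k)          ∎)
      where open ≤-Reasoning
    other-copies : e * q a k + suc L < q a (suc k) + q a k
    other-copies = ≤-<-trans (+-monoˡ-≤ (suc L) (m≤n+m (e * q a k) (q a k))) bound

  period-of-recurs : ∀ {s L} → 0 < s → PrefixRecurs s L → IsPeriodOfPrefix a (s + L) s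
  period-of-recurs {s} {L} 0<s rec = 0<s , m≤m+n s L , λ i 0<i i+s≤s+L → begin
    x a i        ≡⟨ rec i 0<i (+-cancelˡ-≤ s i L (subst (_≤ s + L) (+-comm i s) i+s≤s+L)) ⟨
    x a (s + i)  ≡⟨ cong (x a) (+-comm s i) ⟩
    x a (i + s)  ∎
    where open ≡-Reasoning

  module Ostrowski (t : ℕ) (d : ℕ → ℕ) (d₀<a₁ : d 0 < a 1)
                   (digit-bound : ∀ i → 1 ≤ i → i ≤ t → d i ≤ a (suc i)) where

    headSum : ℕ → ℕ
    headSum = sumTo (λ i → d i * q a i)

    headSum-bound : ∀ {j} → j ≤ t → suc (headSum (suc j)) < q a (suc j) + q a j
    headSum-bound {zero}  _   = subst₂ (λ u v → suc u < v) (sym (*-identityʳ (d 0))) (+-comm 1 (a 1)) (s≤s d₀<a₁)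
    headSum-bound {suc j} j<t = begin-strict
      suc (headSum (suc j)) + d (suc j) * q a (suc j)
        <⟨ +-mono-<-≤ (headSum-bound (<⇒≤ j<t)) (*-monoˡ-≤ (q a (suc j)) (digit-bound (suc j) (s≤s z≤n) j<t)) ⟩
      q a (suc j) + q a j + a (suc (suc j)) * q a (suc j)
        ≡⟨ rearrange (a (suc (suc j))) (q a j) (q a (suc j)) ⟩
      q a (suc (suc j)) + q a (suc j)  ∎
      where
      open ≤-Reasoning
      rearrange : ∀ A Q₀ Q₁ → Q₁ + Q₀ + A * Q₁ ≡ A * Q₁ + Q₀ + Q₁
      rearrange = solve-∀

    tailSum-split : ∀ {j} → j ≤ t → headSum (suc t) ≡ headSum (suc j) + tailSum a d j t
    tailSum-split {j} j≤t = trans (cong (λ n → headSum (suc n)) (sym (m+[n∸m]≡n j≤t))) (sumTo-+ _ (suc j) (t ∸ j))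

    tailSum-last : tailSum a d t t ≡ 0
    tailSum-last = cong (sumTo _) (n∸n≡0 t)

    tailSum-step : ∀ {j} → suc j ≤ t → tailSum a d j t ≡ tailSum a d (suc j) t + d (suc j) * q a (suc j)
    tailSum-step {j} j<t = +-cancelˡ-≡ (headSum (suc j)) _ _ (begin
      headSum (suc j) + tailSum a d j t
        ≡⟨ tailSum-split (<⇒≤ j<t) ⟨
      headSum (suc t)
        ≡⟨ tailSum-split j<t ⟩
      headSum (suc j) + d (suc j) * q a (suc j) + tailSum a d (suc j) t
        ≡⟨ +-assoc (headSum (suc j)) _ _ ⟩
      headSum (suc j) + (d (suc j) * q a (suc j) + tailSum a d (suc j) t)
        ≡⟨ cong (headSum (suc j) +_) (+-comm (d (suc j) * q a (suc j)) _) ⟩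
      headSum (suc j) + (tailSum a d (suc j) t + d (suc j) * q a (suc j))  ∎)
      where open ≡-Reasoning

    recurs-block : ∀ {j e c} → j ≤ t → PrefixRecurs (tailSum a d j t) (headSum (suc j)) → e + c ≡ d j →
                   PrefixRecurs (tailSum a d j t + e * q a j) (c * q a j + headSum j)
    recurs-block {j} {e} {c} j≤t rec e+c≡dⱼ =
      recurs-+ {tailSum a d j t} {e * q a j} (subst (PrefixRecurs (tailSum a d j t)) split rec) (recurs-multiple j e bound)
      where
      split : headSum (suc j) ≡ e * q a j + (c * q a j + headSum j)
      split = trans (cong (λ dⱼ → headSum j + dⱼ * q a j) (sym e+c≡dⱼ)) (regroup (headSum j) e c (q a j))
        where
        regroup : ∀ H e c Q → H + (e + c) * Q ≡ e * Q + (c * Q + H)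
        regroup = solve-∀
      bound : e * q a j + suc (c * q a j + headSum j) < q a (suc j) + q a j
      bound = subst (_< q a (suc j) + q a j) (trans (cong suc split) (sym (+-suc _ _))) (headSum-bound j≤t)

    recurs-tail : ∀ {j} → j ≤ t → PrefixRecurs (tailSum a d j t) (headSum (suc j))
    recurs-tail {j} j≤t = go (t ∸ j) j (m∸n+n≡m j≤t)
      where
      go : ∀ m j → m + j ≡ t → PrefixRecurs (tailSum a d j t) (headSum (suc j))
      go zero    j refl   = subst (λ s → PrefixRecurs s (headSum (suc j))) (sym tailSum-last) (recurs-zero (headSum (suc j)))
      go (suc m) j m+j≡t  = subst (λ s → PrefixRecurs s (headSum (suc j))) (sym (tailSum-step j<t))
        (recurs-block {suc j} {d (suc j)} {0} j<t (go m (suc j) (trans (+-suc m j) m+j≡t)) (+-identityʳ (d (suc j))))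
        where
        j<t : suc j ≤ t
        j<t = subst (suc j ≤_) m+j≡t (s≤s (m≤n+m j m))

lemma8 : (a : ℕ → ℕ) → ValidCF a →
    (n : ℕ) → 1 ≤ n →
    (t : ℕ) (d : ℕ → ℕ) → IsLazyOstrowski a t d n →
    (j e : ℕ) → j ≤ t → 1 ≤ e → e ≤ d j →
    IsPeriodOfPrefix a n (e * q a j + tailSum a d j t)
lemma8 a valid n _ t d (n≡sum , _ , d₀<a₁ , digit-bound , _ , _) j e j≤t 0<e e≤dⱼ =
  subst₂ (IsPeriodOfPrefix a) length (+-comm (tailSum a d j t) (e * q a j))
    (period-of-recurs (≤-trans (*-mono-≤ 0<e (q-pos j)) (m≤n+m (e * q a j) _))
      (recurs-block {j} {e} {d j ∸ e} j≤t (recurs-tail j≤t) (m+[n∸m]≡n e≤dⱼ)))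
  where
  open Sturmian a valid
  open Ostrowski t d d₀<a₁ digit-bound
  length : tailSum a d j t + e * q a j + ((d j ∸ e) * q a j + headSum j) ≡ n
  length = begin
    tailSum a d j t + e * q a j + ((d j ∸ e) * q a j + headSum j) ≡⟨ regroup (tailSum a d j t) e (d j ∸ e) (q a j) (headSum j) ⟩
    headSum j + (e + (d j ∸ e)) * q a j + tailSum a d j t         ≡⟨ cong (λ dⱼ → headSum j + dⱼ * q a j + tailSum a d j t) (m+[n∸m]≡n e≤dⱼ) ⟩
    headSum (suc j) + tailSum a d j t                             ≡⟨ tailSum-split j≤t ⟨
    headSum (suc t)                                               ≡⟨ n≡sum ⟨
    n                                                             ∎
    where
    open ≡-Reasoning
    regroup : ∀ T e c Q H → T + e * Q + (c * Q + H) ≡ H + (e + c) * Q + T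
    regroup = solve-∀
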